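{- Let $\mathsf{A},\mathsf{B}\subseteq\Omega$ be downsets with $\mathsf{B}\subseteq\mathsf{A}$. Then for every $f(\bar\mu,\bar n;\bar a)\in\mathcal{C}_{\mathsf{B}}$ there is $f'(\bar\mu,\bar n;\bar a)\in\mathcal{C}_{\mathsf{A}}$ such that $f(\bar\mu,\bar n;\bar a)=f'(\bar\mu,\bar n;\bar a)$ for all $\bar\mu\in\mathsf{B}$ and all $\bar n,\bar a\in\mathbb{N}$. Consequently, $\mathrm{PredR}_{\mathsf{B}}\subseteq\mathrm{PredR}_{\mathsf{A}}$.
   Context: Constructive ordinals: $\Omega$ is the set of infinitary terms generated by $0$, successor $\alpha+1$, and limits $\langle\alpha_i\rangle_{i\in\mathbb{N}}$. $\prec$ is the transitive closure of $\alpha\prec\alpha+1$ and $\alpha_m\prec\langle\alpha_i\rangle_i$; downsets are subsets of $\Omega$ closed downward under $\prec$. $\mathcal{C}_{\mathsf{A}}$ (for a downset $\mathsf{A}$): functions $f(\bar\mu,\bar n;\bar a)$ (ordinal arguments in $\mathsf{A}$, normal numeral arguments $\bar n$, safe numeral arguments $\bar a$, values in $\mathbb{N}$); smallest class containing nullary $0$, projections onto numeral arguments, $s(;a)=a+1$, $P(;0)=0$, $P(;a+1)=a$, $C(;a,b,c)=b$ if $a=0$ else $c$, closed under predicative ordinal recursion ($f(0,\bar\nu,\bar n;\bar a)=g(\bar\nu,\bar n;\bar a)$, $f(\mu+1,\bar\nu,\bar n;\bar a)=h_{suc}(\mu,\bar\nu,\bar n;f(\mu,\bar\nu,\bar n;\bar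 a),\bar a)$, $f(\langle\mu_i\rangle,\bar\nu,\bar n;\bar a)=h_{lim}(\langle\mu_i\rangle,\bar\nu,\bar n;f(\mu_{q(\bar n;)},\bar\nu,\bar n;\bar a),\bar a)$, $q$ with only normal numeral arguments), safe composition $f(\bar\mu,\bar n;\bar a)=h(\bar\mu,\bar s(\bar\mu,\bar n;);\bar t(\bar\mu,\bar n;\bar a))$, substitution of a constant in $\mathsf{A}$ for an ordinal argument, and exchange/weakening/contraction of ordinal arguments. $\mathrm{PredR}_{\mathsf{A}}$: the $f:\mathbb{N}^k\to\mathbb{N}$ with $f(\bar n)=\hat f(\bar n;)$ for some $\hat f\in\mathcal{C}_{\mathsf{A}}$ with no ordinal and no safe arguments. -}

module Defs where

open import Data.Nat using (ℕ; zero; suc; _∸_)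
open import Data.Fin using (Fin)
open import Data.Vec.Functional using (Vector; []; _∷_)
open import Data.Product using (Σ)
open import Function using (_∘_)
open import Relation.Binary.PropositionalEquality using (_≡_)

data Ω : Set where
  zer : Ω
  suc : Ω → Ω
  lim : (ℕ → Ω) → Ω

data _≺_ : Ω → Ω → Set where
  ≺-suc   : ∀ {α} → α ≺ suc α
  ≺-lim   : ∀ (f : ℕ → Ω) (m : ℕ) → f m ≺ lim f
  ≺-trans : ∀ {α β γ} → α ≺ β → β ≺ γ → α ≺ γ

Subset : Set₁
Subset = Ω → Set

IsDownset : Subset → Set
IsDownset A = ∀ {α β} → α ≺ β → A β → A α

_⊆_ : Subset → Subset → Set
B ⊆ A = ∀ {α} → B α → A α

-- Syntax of the class C_A: Code A k n m describes a function with
-- k ordinal arguments, n normal and m safe numeral arguments.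

data Code (A : Subset) : ℕ → ℕ → ℕ → Set where
  zeroF : Code A 0 0 0
  projN : ∀ {n m} → Fin n → Code A 0 n m
  projS : ∀ {n m} → Fin m → Code A 0 n m
  sucF  : Code A 0 0 1
  predF : Code A 0 0 1
  condF : Code A 0 0 3
  ordRecF : ∀ {k n m}
          → (g    : Code A k n m)
          → (hsuc : Code A (suc k) n (suc m))
          → (hlim : Code A (suc k) n (suc m))
          → (q    : Code A 0 n 0)
          → Code A (suc k) n m
  compF : ∀ {k n m n' m'}
        → (h : Code A k n' m')
        → (s : Fin n' → Code A k n 0)
        → (t : Fin m' → Code A k n m)
        → Code A k n m
  constF : ∀ {k n m} → (c : Ω) → A c → Code A (suc k) n m → Code A k n m
  renameF : ∀ {k k' n m} → (ρ : Fin k → Fin k') → Code A k n m → Code A k' n m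

ordRec : ℕ → (Ω → ℕ → ℕ) → (Ω → ℕ → ℕ) → ℕ → Ω → ℕ
ordRec g hs hl q zer     = g
ordRec g hs hl q (suc μ) = hs μ (ordRec g hs hl q μ)
ordRec g hs hl q (lim μ) = hl (lim μ) (ordRec g hs hl q (μ q))

cond : ℕ → ℕ → ℕ → ℕ
cond zero    b c = b
cond (suc _) b c = c

eval : ∀ {A k n m} → Code A k n m → Vector Ω k → Vector ℕ n → Vector ℕ m → ℕ
eval zeroF        μs ns as = 0
eval (projN j)    μs ns as = ns j
eval (projS j)    μs ns as = as j
eval sucF         μs ns as = suc (as Fin.zero)
  where import Data.Fin as Fin
eval predF        μs ns as = as Fin.zero ∸ 1
  where import Data.Fin as Fin
eval condF        μs ns as = cond (as Fin.zero) (as (Fin.suc Fin.zero)) (as (Fin.suc (Fin.suc Fin.zero)))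
  where import Data.Fin as Fin
eval (ordRecF g hs hl q) μs ns as =
  ordRec (eval g (μs ∘ Fin.suc) ns as)
         (λ μ r → eval hs (μ ∷ (μs ∘ Fin.suc)) ns (r ∷ as))
         (λ μ r → eval hl (μ ∷ (μs ∘ Fin.suc)) ns (r ∷ as))
         (eval q [] ns [])
         (μs Fin.zero)
  where import Data.Fin as Fin
eval (compF h s t) μs ns as = eval h μs (λ j → eval (s j) μs ns []) (λ j → eval (t j) μs ns as)
eval (constF c _ f) μs ns as = eval f (c ∷ μs) ns as
eval (renameF ρ f)  μs ns as = eval f (μs ∘ ρ) ns as

PredR : Subset → (n : ℕ) → ((Vector ℕ n) → ℕ) → Set
PredR A n f = Σ (Code A 0 n 0) λ c → ∀ ns → f ns ≡ eval c [] ns []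

-- A code over B is also a code over A once its constant ordinals, the only
-- place where the downset appears in the syntax, are read as elements of A.
-- This relabelling changes nothing in the evaluation, so it computes the same
-- function on every ordinal argument, not only on those in B.
module Submission where

open import Defs
open import Data.Nat using (ℕ; suc; _∸_)
import Data.Fin as Fin
open import Data.Vec.Functional using (Vector; []; _∷_)
open import Data.Product using (Σ; _×_; _,_)
open import Relation.Binary.PropositionalEquality
  using (_≡_; _≗_; refl; cong; trans)

mapCode : ∀ {A B k n m} → B ⊆ A → Code B k n m → Code A k n m
mapCode B⊆A zeroF               = zeroF
mapCode B⊆A (projN j)           = projN j
mapCode B⊆A (projS j)           = projS j
mapCode B⊆A sucF                = sucF
mapCode B⊆A predF               = predF
mapCode B⊆A condF               = condF
mapCode B⊆A (ordRecF g hs hl q) =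
  ordRecF (mapCode B⊆A g) (mapCode B⊆A hs) (mapCode B⊆A hl) (mapCode B⊆A q)
mapCode B⊆A (compF h s t)       =
  compF (mapCode B⊆A h) (λ j → mapCode B⊆A (s j)) (λ j → mapCode B⊆A (t j))
mapCode B⊆A (constF c c∈B f)    = constF c (B⊆A c∈B) (mapCode B⊆A f)
mapCode B⊆A (renameF ρ f)       = renameF ρ (mapCode B⊆A f)

∷-cong : ∀ {X : Set} {k} {x y : X} {u v : Vector X k} →
         x ≡ y → u ≗ v → (x ∷ u) ≗ (y ∷ v)
∷-cong x≡y u≗v Fin.zero    = x≡y
∷-cong x≡y u≗v (Fin.suc i) = u≗v i

ordRec-cong : ∀ {g g' q q' : ℕ} {hs hs' hl hl' : Ω → ℕ → ℕ} →
              g ≡ g' → (∀ μ → hs μ ≗ hs' μ) → (∀ μ → hl μ ≗ hl' μ) → q ≡ q' →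
              ordRec g hs hl q ≗ ordRec g' hs' hl' q'
ordRec-cong g≡ hs≗ hl≗ q≡ zer = g≡
ordRec-cong {hs' = hs'} g≡ hs≗ hl≗ q≡ (suc μ) =
  trans (hs≗ μ _) (cong (hs' μ) (ordRec-cong g≡ hs≗ hl≗ q≡ μ))
ordRec-cong {hl' = hl'} g≡ hs≗ hl≗ refl (lim μ) =
  trans (hl≗ (lim μ) _) (cong (hl' (lim μ)) (ordRec-cong g≡ hs≗ hl≗ refl (μ _)))

-- Stated for pointwise equal numeral environments rather than identical ones:
-- composition feeds the inner functions' values to the outer one as vectors,
-- and without function extensionality these agree only pointwise.
eval-mapCode : ∀ {A B k n m} (B⊆A : B ⊆ A) (f : Code B k n m) μs
               {ns ns' : Vector ℕ n} {as as' : Vector ℕ m} →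
               ns ≗ ns' → as ≗ as' →
               eval f μs ns as ≡ eval (mapCode B⊆A f) μs ns' as'
eval-mapCode B⊆A zeroF     μs ns≗ as≗ = refl
eval-mapCode B⊆A (projN j) μs ns≗ as≗ = ns≗ j
eval-mapCode B⊆A (projS j) μs ns≗ as≗ = as≗ j
eval-mapCode B⊆A sucF      μs ns≗ as≗ = cong suc (as≗ Fin.zero)
eval-mapCode B⊆A predF     μs ns≗ as≗ = cong (_∸ 1) (as≗ Fin.zero)
eval-mapCode B⊆A condF     μs ns≗ as≗
  rewrite as≗ Fin.zero | as≗ (Fin.suc Fin.zero) | as≗ (Fin.suc (Fin.suc Fin.zero)) = refl
eval-mapCode B⊆A (ordRecF g hs hl q) μs ns≗ as≗ =
  ordRec-cong (eval-mapCode B⊆A g _ ns≗ as≗)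
              (λ μ r → eval-mapCode B⊆A hs _ ns≗ (∷-cong refl as≗))
              (λ μ r → eval-mapCode B⊆A hl _ ns≗ (∷-cong refl as≗))
              (eval-mapCode B⊆A q [] ns≗ λ ())
              (μs Fin.zero)
eval-mapCode B⊆A (compF h s t) μs ns≗ as≗ =
  eval-mapCode B⊆A h μs (λ j → eval-mapCode B⊆A (s j) μs ns≗ λ ())
                        (λ j → eval-mapCode B⊆A (t j) μs ns≗ as≗)
eval-mapCode B⊆A (constF c _ f) μs ns≗ as≗ = eval-mapCode B⊆A f (c ∷ μs) ns≗ as≗
eval-mapCode B⊆A (renameF ρ f)  μs ns≗ as≗ = eval-mapCode B⊆A f _ ns≗ as≗

PredR-mono : ∀ {A B} → B ⊆ A → ∀ n f → PredR B n f → PredR A n f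
PredR-mono B⊆A n f (c , f≡c) =
  mapCode B⊆A c , λ ns → trans (f≡c ns) (eval-mapCode B⊆A c [] (λ _ → refl) λ ())

lemma5p12 : (A B : Subset) → IsDownset A → IsDownset B → B ⊆ A
    → ((k n m : ℕ) (f : Code B k n m)
        → Σ (Code A k n m) λ f' → (μs : Vector Ω k) → (∀ i → B (μs i))
          → (ns : Vector ℕ n) (as : Vector ℕ m) → eval f μs ns as ≡ eval f' μs ns as)
      × ((n : ℕ) (f : Vector ℕ n → ℕ) → PredR B n f → PredR A n f)
lemma5p12 A B _ _ B⊆A =
    (λ k n m f → mapCode B⊆A f ,
                 λ μs _ ns as → eval-mapCode B⊆A f μs (λ _ → refl) (λ _ → refl))
  , PredR-mono B⊆A
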